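{- Let $X$ be a complete orthomodular lattice, $a\in X$, and $\pi_a\colon X\to X$, $\pi_a(y)=a\wedge(a^{\perp}\vee y)$, the Sasaki projection. Then the (essentially unique) factorization of $\pi_a$ in $\mathbf{SupOMLatLin}$ as a zero-epi followed by a dagger kernel is $\pi_a=\pi_a|_{\downarrow a}\circ\pi_a|^{\downarrow a}$, where $\pi_a|^{\downarrow a}\colon X\to\downarrow a$ is the corestriction and $\pi_a|_{\downarrow a}\colon\downarrow a\to X$ is the restriction. Moreover, $\pi_a|^{\downarrow a}$ is dagger epi, $\pi_a|_{\downarrow a}$ is dagger mono, $\pi_a|^{\downarrow a}=(\pi_a|_{\downarrow a})^{*}$, and $\pi_a|^{\downarrow a}\circ\pi_a|_{\downarrow a}=\mathrm{id}_{\downarrow a}$.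
   Context: An orthomodular lattice is a lattice with $0,1$ and an involutive, order-reversing orthocomplement $x\mapsto x^\perp$ with $x\wedge x^\perp=0$, satisfying $x\le y\Rightarrow y=x\vee(x^\perp\wedge y)$; complete means all joins exist. $x\perp y$ means $x\le y^\perp$. $\mathbf{SupOMLatLin}$ has complete orthomodular lattices as objects and linear maps as morphisms ($f\colon X\to Y$ with a unique $f^{*}$ such that $f(x)\perp y$ iff $x\perp f^{*}(y)$), dagger $f\mapsto f^*$, zero object $\{0\}$; it is a dagger kernel category (dagger kernel of $g\colon A\to B$: inclusion $\downarrow g^*(1)^\perp\to A$). $\downarrow a=\{u\in X\colon u\le a\}$ is a complete orthomodular lattice with the order of $X$ and orthocomplement $u\mapsto a\wedge u^\perp$. A morphism $e$ is zero-epi if $g\circ e=0$ implies $g=0$; $m$ is dagger mono if $m^*\circ m=\mathrm{id}$; $e$ is dagger epi if $e\circ e^*=\mathrm{id}$. -}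

module Defs where

open import Level using (Level; suc; _⊔_)
open import Data.Product using (Σ; Σ-syntax; _×_; _,_; proj₁; proj₂)

-- The underlying order is given as a relation _≤_ that is reflexive and
-- transitive; equality of elements is the induced equivalence _≈_
-- (x ≤ y and y ≤ x), i.e. antisymmetry holds up to _≈_ (setoid style).

record OrthoData (ℓ : Level) : Set (suc ℓ) where
  infix 4 _≤_
  infix 9 _ᗮ
  field
    Carrier : Set ℓ
    _≤_     : Carrier → Carrier → Set ℓ
    _ᗮ      : Carrier → Carrier

module _ {ℓ : Level} (D : OrthoData ℓ) where
  open OrthoData D

  Eq : Carrier → Carrier → Set ℓ
  Eq x y = (x ≤ y) × (y ≤ x)

  Orth : Carrier → Carrier → Set ℓ
  Orth x y = x ≤ y ᗮ

record IsCompleteOML {ℓ : Level} (D : OrthoData ℓ) : Set (suc ℓ) where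
  open OrthoData D
  infixr 7 _∧_
  infixr 6 _∨_
  field
    ≤-refl   : ∀ {x} → x ≤ x
    ≤-trans  : ∀ {x y z} → x ≤ y → y ≤ z → x ≤ z
    𝟘 𝟙      : Carrier
    𝟘-least  : ∀ {x} → 𝟘 ≤ x
    𝟙-great  : ∀ {x} → x ≤ 𝟙
    _∧_ _∨_  : Carrier → Carrier → Carrier
    ∧-lb₁    : ∀ {x y} → x ∧ y ≤ x
    ∧-lb₂    : ∀ {x y} → x ∧ y ≤ y
    ∧-glb    : ∀ {x y z} → z ≤ x → z ≤ y → z ≤ x ∧ y
    ∨-ub₁    : ∀ {x y} → x ≤ x ∨ y
    ∨-ub₂    : ∀ {x y} → y ≤ x ∨ y
    ∨-lub    : ∀ {x y z} → x ≤ z → y ≤ z → x ∨ y ≤ z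
    ⋁        : (Carrier → Set ℓ) → Carrier
    ⋁-ub     : ∀ {P : Carrier → Set ℓ} {x} → P x → x ≤ ⋁ P
    ⋁-lub    : ∀ {P : Carrier → Set ℓ} {z} → (∀ x → P x → x ≤ z) → ⋁ P ≤ z
    ᗮ-invol₁ : ∀ {x} → x ᗮ ᗮ ≤ x
    ᗮ-invol₂ : ∀ {x} → x ≤ x ᗮ ᗮ
    ᗮ-anti   : ∀ {x y} → x ≤ y → y ᗮ ≤ x ᗮ
    ᗮ-compl  : ∀ {x} → x ∧ x ᗮ ≤ 𝟘
    orthomod : ∀ {x y} → x ≤ y → y ≤ x ∨ (x ᗮ ∧ y)

record COML (ℓ : Level) : Set (suc ℓ) where
  field
    dat    : OrthoData ℓ
    struct : IsCompleteOML dat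
  open OrthoData dat public
  open IsCompleteOML struct public
  _≈_ : Carrier → Carrier → Set ℓ
  _≈_ = Eq dat
  _⊥_ : Carrier → Carrier → Set ℓ
  _⊥_ = Orth dat
  infix 4 _≈_ _⊥_


-- Linear maps (morphisms of SupOMLatLin): f with an adjoint f* such that
-- f(x) ⊥ y  iff  x ⊥ f*(y).  (The adjoint is unique up to ≈.)
-- Morphisms are compared pointwise up to ≈.

record Hom {ℓ : Level} (X Y : COML ℓ) : Set ℓ where
  field
    fun       : COML.Carrier X → COML.Carrier Y
    adj       : COML.Carrier Y → COML.Carrier X
    adjoint→  : ∀ x y → COML._⊥_ Y (fun x) y → COML._⊥_ X x (adj y)
    adjoint←  : ∀ x y → COML._⊥_ X x (adj y) → COML._⊥_ Y (fun x) y

open Hom public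

module _ {ℓ : Level} where

  CompIsZero : {X Y Z : COML ℓ} → Hom Y Z → Hom X Y → Set ℓ
  CompIsZero {X} {Y} {Z} g f = ∀ x → COML._≈_ Z (fun g (fun f x)) (COML.𝟘 Z)

  IsZero : {X Y : COML ℓ} → Hom X Y → Set ℓ
  IsZero {X} {Y} f = ∀ x → COML._≈_ Y (fun f x) (COML.𝟘 Y)

  ZeroEpi : {X Y : COML ℓ} → Hom X Y → Set (suc ℓ)
  ZeroEpi {X} {Y} e = ∀ (Z : COML ℓ) (g : Hom Y Z) → CompIsZero g e → IsZero g

  DaggerMono : {X Y : COML ℓ} → Hom X Y → Set ℓ
  DaggerMono {X} {Y} m = ∀ x → COML._≈_ X (adj m (fun m x)) x

  DaggerEpi : {X Y : COML ℓ} → Hom X Y → Set ℓ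
  DaggerEpi {X} {Y} e = ∀ y → COML._≈_ Y (fun e (adj e y)) y

  IsKernel : {K B C : COML ℓ} → Hom K B → Hom B C → Set (suc ℓ)
  IsKernel {K} {B} {C} m g =
    CompIsZero g m ×
    (∀ (W : COML ℓ) (f : Hom W B) → CompIsZero g f →
       Σ (Hom W K) λ h →
         (∀ w → COML._≈_ B (fun m (fun h w)) (fun f w)) ×
         (∀ (h' : Hom W K) → (∀ w → COML._≈_ B (fun m (fun h' w)) (fun f w)) →
            ∀ w → COML._≈_ K (fun h' w) (fun h w)))

  IsDaggerKernel : {K B : COML ℓ} → Hom K B → Set (suc ℓ)
  IsDaggerKernel {K} {B} m =
    Σ (COML ℓ) λ C → Σ (Hom B C) λ g → IsKernel m g × DaggerMono m

module _ {ℓ : Level} (X : COML ℓ) where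
  open COML X

  sasaki : Carrier → Carrier → Carrier
  sasaki a y = a ∧ (a ᗮ ∨ y)

  private
    ∨-mono : ∀ {x y x' y'} → x ≤ x' → y ≤ y' → x ∨ y ≤ x' ∨ y'
    ∨-mono p q = ∨-lub (≤-trans p ∨-ub₁) (≤-trans q ∨-ub₂)

  downData : Carrier → OrthoData ℓ
  downData a = record
    { Carrier = Σ Carrier (λ u → u ≤ a)
    ; _≤_     = λ u v → proj₁ u ≤ proj₁ v
    ; _ᗮ      = λ u → (a ∧ proj₁ u ᗮ , ∧-lb₁)
    }

  downStruct : (a : Carrier) → IsCompleteOML (downData a)
  downStruct a = record
    { ≤-refl   = ≤-refl
    ; ≤-trans  = ≤-trans
    ; 𝟘        = 𝟘 , 𝟘-least
    ; 𝟙        = a , ≤-refl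
    ; 𝟘-least  = 𝟘-least
    ; 𝟙-great  = λ {x} → proj₂ x
    ; _∧_      = λ u v → (proj₁ u ∧ proj₁ v , ≤-trans ∧-lb₁ (proj₂ u))
    ; _∨_      = λ u v → (proj₁ u ∨ proj₁ v , ∨-lub (proj₂ u) (proj₂ v))
    ; ∧-lb₁    = ∧-lb₁
    ; ∧-lb₂    = ∧-lb₂
    ; ∧-glb    = ∧-glb
    ; ∨-ub₁    = ∨-ub₁
    ; ∨-ub₂    = ∨-ub₂
    ; ∨-lub    = ∨-lub
    ; ⋁        = λ P → ( ⋁ (λ x → Σ (x ≤ a) λ p → P (x , p))
                       , ⋁-lub (λ x q → proj₁ q) )
    ; ⋁-ub     = λ {P} {x} px → ⋁-ub (proj₂ x , px)
    ; ⋁-lub    = λ {P} {z} h → ⋁-lub (λ x q → h (x , proj₁ q) (proj₂ q))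
    ; ᗮ-invol₁ = λ {u} → invol₁ (proj₁ u) (proj₂ u)
    ; ᗮ-invol₂ = λ {u} → ∧-glb (proj₂ u)
                   (≤-trans ᗮ-invol₂ (ᗮ-anti ∧-lb₂))
    ; ᗮ-anti   = λ p → ∧-glb ∧-lb₁ (≤-trans ∧-lb₂ (ᗮ-anti p))
    ; ᗮ-compl  = ≤-trans (∧-glb ∧-lb₁ (≤-trans ∧-lb₂ ∧-lb₂)) ᗮ-compl
    ; orthomod = λ {u} {v} p →
        ≤-trans (orthomod p)
          (∨-mono ≤-refl
            (∧-glb (∧-glb (≤-trans ∧-lb₂ (proj₂ v)) ∧-lb₁) ∧-lb₂))
    }
    where
    invol₁ : ∀ u → u ≤ a → a ∧ (a ∧ u ᗮ) ᗮ ≤ u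
    invol₁ u u≤a =
      ≤-trans (orthomod {u} {a ∧ w ᗮ} u≤y)
        (∨-lub ≤-refl
          (≤-trans (∧-glb (∧-glb (≤-trans ∧-lb₂ ∧-lb₁) ∧-lb₁)
                          (≤-trans ∧-lb₂ ∧-lb₂))
             (≤-trans ᗮ-compl 𝟘-least)))
      where
      w = a ∧ u ᗮ
      u≤y : u ≤ a ∧ w ᗮ
      u≤y = ∧-glb u≤a (≤-trans ᗮ-invol₂ (ᗮ-anti ∧-lb₂))

  down : Carrier → COML ℓ
  down a = record { dat = downData a ; struct = downStruct a }

-- The Sasaki projection πₐ is self-adjoint, because it is the left adjoint of
-- the Sasaki hook b ↦ aᗮ ∨ (a ∧ b) and (πₐ y)ᗮ = aᗮ ∨ (a ∧ yᗮ).  By the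
-- orthomodular law πₐ fixes every u ≤ a.  Hence the inclusion ↓a → X and the
-- corestriction X → ↓a of πₐ are adjoint to each other, and their composite
-- ↓a → X → ↓a is the identity.  The inclusion is the kernel of π_{aᗮ}, whose
-- zero set is ↓a, and the corestriction, being dagger epi, is zero-epi.
module Submission where

open import Defs
open import Level using (Level)
open import Data.Product using (Σ; _×_; _,_; proj₁; proj₂)

module OrthoLattice {ℓ : Level} (X : COML ℓ) where
  open COML X

  ≈-refl : ∀ {x} → x ≈ x
  ≈-refl = ≤-refl , ≤-refl

  ≈-sym : ∀ {x y} → x ≈ y → y ≈ x
  ≈-sym (p , q) = q , p

  ≈-trans : ∀ {x y z} → x ≈ y → y ≈ z → x ≈ z
  ≈-trans (p , q) (p' , q') = ≤-trans p p' , ≤-trans q' q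

  ∨-mono : ∀ {x y x' y'} → x ≤ x' → y ≤ y' → x ∨ y ≤ x' ∨ y'
  ∨-mono p q = ∨-lub (≤-trans p ∨-ub₁) (≤-trans q ∨-ub₂)

  ∧-mono : ∀ {x y x' y'} → x ≤ x' → y ≤ y' → x ∧ y ≤ x' ∧ y'
  ∧-mono p q = ∧-glb (≤-trans ∧-lb₁ p) (≤-trans ∧-lb₂ q)

  ᗮ-swapʳ : ∀ {x y} → x ≤ y ᗮ → y ≤ x ᗮ
  ᗮ-swapʳ p = ≤-trans ᗮ-invol₂ (ᗮ-anti p)

  ᗮ-swapˡ : ∀ {x y} → x ᗮ ≤ y → y ᗮ ≤ x
  ᗮ-swapˡ p = ≤-trans (ᗮ-anti p) ᗮ-invol₁

  ≤ᗮ-∨ : ∀ {z x y} → z ≤ x ᗮ → z ≤ y ᗮ → z ≤ (x ∨ y) ᗮ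
  ≤ᗮ-∨ p q = ᗮ-swapʳ (∨-lub (ᗮ-swapʳ p) (ᗮ-swapʳ q))

  ᗮ-∧-≤ : ∀ {x y} → (x ∧ y) ᗮ ≤ x ᗮ ∨ y ᗮ
  ᗮ-∧-≤ = ᗮ-swapˡ (∧-glb (ᗮ-swapˡ ∨-ub₁) (ᗮ-swapˡ ∨-ub₂))

module SasakiProjection {ℓ : Level} (X : COML ℓ) where
  open COML X
  open OrthoLattice X

  sasakiHook : Carrier → Carrier → Carrier
  sasakiHook a b = a ᗮ ∨ (a ∧ b)

  sasaki-fixes : ∀ {a u} → u ≤ a → sasaki X a u ≈ u
  sasaki-fixes {a} {u} u≤a = πu≤u , ∧-glb u≤a ∨-ub₂
    where
    πu = sasaki X a u
    πu≤u : πu ≤ u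
    πu≤u = ≤-trans (orthomod (∧-glb u≤a ∨-ub₂))
      (∨-lub ≤-refl (≤-trans (∧-glb (≤-trans ∧-lb₂ ∧-lb₂) uᗮ∧πu≤πuᗮ)
                             (≤-trans ᗮ-compl 𝟘-least)))
      where
      uᗮ∧πu≤πuᗮ : u ᗮ ∧ πu ≤ (a ᗮ ∨ u) ᗮ
      uᗮ∧πu≤πuᗮ = ≤ᗮ-∨ (≤-trans ∧-lb₂ (≤-trans ∧-lb₁ ᗮ-invol₂)) ∧-lb₁

  sasaki-≤⇒≤-hook : ∀ {a x b} → sasaki X a x ≤ b → x ≤ sasakiHook a b
  sasaki-≤⇒≤-hook {a} {x} p = ≤-trans x≤aᗮ∨πx (∨-mono ≤-refl (∧-glb ∧-lb₁ p))
    where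
    x≤aᗮ∨πx : x ≤ a ᗮ ∨ sasaki X a x
    x≤aᗮ∨πx = ≤-trans ∨-ub₂ (≤-trans (orthomod ∨-ub₁)
                (∨-mono ≤-refl (∧-mono ᗮ-invol₁ ≤-refl)))

  ≤-hook⇒sasaki-≤ : ∀ {a x b} → x ≤ sasakiHook a b → sasaki X a x ≤ b
  ≤-hook⇒sasaki-≤ p = ≤-trans (∧-mono ≤-refl (∨-lub ∨-ub₁ p))
                        (≤-trans (proj₁ (sasaki-fixes ∧-lb₁)) ∧-lb₂)

  sasakiᗮ≈hook : ∀ {a y} → (sasaki X a y) ᗮ ≈ sasakiHook a (y ᗮ)
  sasakiᗮ≈hook =
    ≤-trans ᗮ-∧-≤ (∨-mono ≤-refl (∧-glb (ᗮ-swapˡ ∨-ub₁) (ᗮ-anti ∨-ub₂)))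
    , ∨-lub (ᗮ-anti ∧-lb₁)
            (≤-trans (≤ᗮ-∨ (≤-trans ∧-lb₁ ᗮ-invol₂) ∧-lb₂) (ᗮ-anti ∧-lb₂))

  sasaki-⊥→ : ∀ {a x y} → sasaki X a x ⊥ y → x ⊥ sasaki X a y
  sasaki-⊥→ p = ≤-trans (sasaki-≤⇒≤-hook p) (proj₂ sasakiᗮ≈hook)

  sasaki-⊥← : ∀ {a x y} → x ⊥ sasaki X a y → sasaki X a x ⊥ y
  sasaki-⊥← p = ≤-hook⇒sasaki-≤ (≤-trans p (proj₁ sasakiᗮ≈hook))

  sasakiHom : Carrier → Hom X X
  sasakiHom a = record
    { fun = sasaki X a ; adj = sasaki X a
    ; adjoint→ = λ _ _ → sasaki-⊥→ ; adjoint← = λ _ _ → sasaki-⊥← }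

  sasaki≤𝟘⇒⊥ : ∀ {a x} → sasaki X a x ≤ 𝟘 → x ⊥ a
  sasaki≤𝟘⇒⊥ p = ≤-trans (sasaki-≤⇒≤-hook p) (∨-lub ≤-refl (≤-trans ∧-lb₂ 𝟘-least))

  ⊥⇒sasaki≤𝟘 : ∀ {a x} → x ⊥ a → sasaki X a x ≤ 𝟘
  ⊥⇒sasaki≤𝟘 p = ≤-trans (∧-mono ≤-refl (∨-lub ≤-refl p)) ᗮ-compl

module LinearMap {ℓ : Level} {X Y : COML ℓ} (f : Hom X Y) where
  private
    module X = COML X
    module Y = COML Y

  fun-mono : ∀ {x x'} → x X.≤ x' → fun f x Y.≤ fun f x'
  fun-mono {x} {x'} p = Y.≤-trans (adjoint← f x y x⊥f*y) Y.ᗮ-invol₁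
    where
    y = fun f x' Y.ᗮ
    x⊥f*y : x X.⊥ adj f y
    x⊥f*y = X.≤-trans p (adjoint→ f x' y Y.ᗮ-invol₂)

daggerEpi⇒zeroEpi : ∀ {ℓ} {X Y : COML ℓ} (e : Hom X Y) → DaggerEpi e → ZeroEpi e
daggerEpi⇒zeroEpi e ee*≈id Z g ge≈𝟘 y =
  COML.≤-trans Z (LinearMap.fun-mono g (proj₂ (ee*≈id y))) (proj₁ (ge≈𝟘 (adj e y)))
  , COML.𝟘-least Z

module DownSet {ℓ : Level} (X : COML ℓ) (a : COML.Carrier X) where
  open COML X
  open OrthoLattice X
  open SasakiProjection X

  ↓a : COML ℓ
  ↓a = down X a

  inclusion : Hom ↓a X
  inclusion = record
    { fun = proj₁
    ; adj = λ y → sasaki X a y , ∧-lb₁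
    ; adjoint→ = λ u y p →
        ∧-glb (proj₂ u) (sasaki-⊥→ (≤-trans (proj₁ (sasaki-fixes (proj₂ u))) p))
    ; adjoint← = λ u y p →
        ≤-trans (proj₂ (sasaki-fixes (proj₂ u))) (sasaki-⊥← (≤-trans p ∧-lb₂))
    }

  corestrict : {W : COML ℓ} (f : Hom W X) → (∀ w → fun f w ≤ a) → Hom W ↓a
  corestrict f fw≤a = record
    { fun = λ w → fun f w , fw≤a w
    ; adj = λ u → adj f (proj₁ u)
    ; adjoint→ = λ w u p → adjoint→ f w (proj₁ u) (≤-trans p ∧-lb₂)
    ; adjoint← = λ w u p → ∧-glb (fw≤a w) (adjoint← f w (proj₁ u) p)
    }

  inclusion-daggerMono : DaggerMono inclusion
  inclusion-daggerMono u = sasaki-fixes (proj₂ u)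

  inclusion-isKernel : {Y : COML ℓ} (g : Hom X Y) →
    (∀ {x} → COML._≤_ Y (fun g x) (COML.𝟘 Y) → x ≤ a) →
    (∀ {x} → x ≤ a → COML._≤_ Y (fun g x) (COML.𝟘 Y)) →
    IsKernel inclusion g
  inclusion-isKernel {Y} g zero⇒≤a ≤a⇒zero =
    (λ u → ≤a⇒zero (proj₂ u) , COML.𝟘-least Y) , factor
    where
    factor : ∀ (W : COML ℓ) (f : Hom W X) → CompIsZero g f →
      Σ (Hom W ↓a) λ h →
        (∀ w → proj₁ (fun h w) ≈ fun f w) ×
        (∀ (h' : Hom W ↓a) → (∀ w → proj₁ (fun h' w) ≈ fun f w) →
           ∀ w → proj₁ (fun h' w) ≈ proj₁ (fun h w))
    factor W f gf≈𝟘 =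
      corestrict f (λ w → zero⇒≤a (proj₁ (gf≈𝟘 w))) , (λ _ → ≈-refl) , λ _ h'≈f → h'≈f

  inclusion-daggerKernel : IsDaggerKernel inclusion
  inclusion-daggerKernel =
    X , sasakiHom (a ᗮ)
    , inclusion-isKernel (sasakiHom (a ᗮ))
        (λ p → ≤-trans (sasaki≤𝟘⇒⊥ p) ᗮ-invol₁)
        (λ p → ⊥⇒sasaki≤𝟘 (≤-trans p ᗮ-invol₂))
    , inclusion-daggerMono

corollary16 : {ℓ : Level} (X : COML ℓ) (a : COML.Carrier X) →
    Σ (Hom X X) λ π →
    Σ (Hom X (down X a)) λ c →
    Σ (Hom (down X a) X) λ r →
      (∀ y → COML._≈_ X (fun π y) (sasaki X a y)) ×
      (∀ y → COML._≈_ X (proj₁ (fun c y)) (sasaki X a y)) ×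
      (∀ u → COML._≈_ X (fun r u) (sasaki X a (proj₁ u))) ×
      (∀ y → COML._≈_ X (fun π y) (fun r (fun c y))) ×
      ZeroEpi c ×
      IsDaggerKernel r ×
      DaggerEpi c ×
      DaggerMono r ×
      (∀ y → COML._≈_ (down X a) (fun c y) (adj r y)) ×
      (∀ u → COML._≈_ (down X a) (fun c (fun r u)) u)
corollary16 X a =
  sasakiHom a , corestriction , inclusion
  , (λ _ → ≈-refl) , (λ _ → ≈-refl) , (λ u → ≈-sym (sasaki-fixes (proj₂ u)))
  , (λ _ → ≈-refl)
  , daggerEpi⇒zeroEpi corestriction corestriction-daggerEpi
  , inclusion-daggerKernel
  , corestriction-daggerEpi
  , inclusion-daggerMono
  , (λ _ → ≈-refl)
  , inclusion-daggerMono
  where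
  open COML X
  open OrthoLattice X
  open SasakiProjection X
  open DownSet X a

  corestriction : Hom X ↓a
  corestriction = corestrict (sasakiHom a) (λ _ → ∧-lb₁)

  corestriction-daggerEpi : DaggerEpi corestriction
  corestriction-daggerEpi u = ≈-trans (sasaki-fixes ∧-lb₁) (sasaki-fixes (proj₂ u))
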